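{- Let $k\ge 4$, $n=2k-1$, $\eta=(\eta_1<\dots<\eta_l)\in\mathbb{D}_k\setminus\{(3,k-3)\}$, let $Y_{2\eta^*}$ be the Young diagram whose main diagonal consists of exactly the $l+1$ cells $c_{1,1},\dots,c_{l+1,l+1}$ with $h_{1,1}=2n-4$, $h_{i,i}=2\eta_{l-(i-2)}$ ($2\le i\le l+1$) and $a(c_{i,i})=l(c_{i,i})+1$ ($1\le i\le l+1$), and let $\lambda$ be the partition whose parts are the hook lengths of the first-column cells of $Y_{2\eta^*}$. Then $\lambda$ is a partition of $T_n=n(n+1)/2$.
   Context: $\mathbb{D}_k$ is the set of partitions of $k$ into distinct parts with at least two parts. Young diagrams in English convention; $c_{i,j}$ is the cell in row $i$, column $j$; $a(c_{i,j})$ (arm) is the number of cells to its right, $l(c_{i,j})$ (leg) the number below it, and $h_{i,j}=a(c_{i,j})+l(c_{i,j})+1$. -}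

module Defs where

open import Data.Nat using (ℕ; zero; suc; _+_; _*_; _∸_; _<_; _≥_; _<?_)
open import Data.Nat.DivMod using (_/_)
open import Data.List using (List; []; _∷_; length; filter; map; upTo; reverse)
open import Data.Nat.ListAction using (sum)
open import Data.List.Relation.Unary.All using (All)
open import Data.List.Relation.Unary.Linked using (Linked)
open import Data.Product using (_×_)
open import Relation.Binary.PropositionalEquality using (_≡_; _≢_)

-- A Young diagram (English convention) is given by its list of row lengths
-- (row 1 first): weakly decreasing and all positive.
IsYoungDiagram : List ℕ → Set
IsYoungDiagram Y = Linked _≥_ Y × All (0 <_) Y

-- Rows and columns are indexed from 0 here: cell c_{i,j} of the paper
-- is (i - 1, j - 1).  Length of row i (0 if there is no such row).
rowLen : List ℕ → ℕ → ℕ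
rowLen []       _       = 0
rowLen (r ∷ _)  zero    = r
rowLen (_ ∷ rs) (suc i) = rowLen rs i

colLen : List ℕ → ℕ → ℕ
colLen Y j = length (filter (j <?_) Y)

arm : List ℕ → ℕ → ℕ → ℕ
arm Y i j = rowLen Y i ∸ suc j

leg : List ℕ → ℕ → ℕ → ℕ
leg Y i j = colLen Y j ∸ suc i

hook : List ℕ → ℕ → ℕ → ℕ
hook Y i j = arm Y i j + leg Y i j + 1

diagLen : List ℕ → ℕ
diagLen Y = length (filter (λ i → i <? rowLen Y i) (upTo (length Y)))

diagHooks : List ℕ → List ℕ
diagHooks Y = map (λ i → hook Y i i) (upTo (diagLen Y))

firstColHooks : List ℕ → List ℕ
firstColHooks Y = map (λ i → hook Y i 0) (upTo (length Y))

InD : ℕ → List ℕ → Set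
InD k η = Linked _<_ η × All (0 <_) η × (2 Data.Nat.≤ length η) × (sum η ≡ k)

IsPartitionOf : List ℕ → ℕ → Set
IsPartitionOf μ m = Linked _≥_ μ × All (0 <_) μ × (sum μ ≡ m)

T : ℕ → ℕ
T n = n * (n + 1) / 2

{-# OPTIONS --safe #-}
module Submission where

-- Frobenius: |Y| is the sum of the diagonal hook lengths, because the hook of c₁₁ is the first
-- row together with the first column, and deleting both leaves a diagram whose diagonal hooks
-- are the remaining ones.  Hence |Y| = (2n − 4) + 2|η| = 3n − 3.  As l(c₁₁) + 1 is the number L
-- of rows, a(c₁₁) = l(c₁₁) + 1 gives h₁₁ = 2L, so L = n − 2.  The hook of the first-column cell
-- of a row is its length plus the number of rows below it, so these hooks decrease and sum to
-- |Y| + (0 + 1 + ⋯ + (L − 1)) = n + (n − 1) + (n − 2) + T (n − 3) = T n.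

open import Defs
open import Data.Nat using (ℕ; zero; suc; _+_; _*_; _∸_; _≤_; _≥_; _<_; _<?_; _<ᵇ_; z≤n; s≤s; z<s; s<s; s≤s⁻¹; s<s⁻¹; pred)
open import Data.Nat.Properties
open import Data.Nat.DivMod using (_/_; m*n/n≡m)
open import Data.Nat.ListAction using (sum)
open import Data.Nat.ListAction.Properties using (sum-↭)
open import Data.Nat.Tactic.RingSolver using (solve-∀)
open import Data.List using (List; []; _∷_; length; map; reverse; filter; applyUpTo; upTo)
open import Data.List.Properties using (∷-injectiveˡ; filter-accept; filter-reject; filter-all; filter-none; map-upTo)
open import Data.List.Relation.Binary.Permutation.Propositional.Properties using (↭-reverse)
open import Data.List.Relation.Unary.All as All using (All; []; _∷_)
open import Data.List.Relation.Unary.All.Properties as All using (all-filter)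
open import Data.List.Relation.Unary.Linked as Linked using (Linked; []; [-]; _∷_)
open import Data.List.Relation.Unary.Linked.Properties as Linked using (Linked⇒All)
open import Data.Bool using (true; false)
open import Data.Sum using (inj₁; inj₂)
open import Data.Product using (_×_; _,_; ∃-syntax)
open import Function using (id; _∘_; flip; _⇔_; mk⇔; Equivalence)
open import Function.Construct.Composition using (_⇔-∘_)
open import Relation.Nullary using (¬_; yes; no; contradiction)
open import Relation.Unary using (Decidable)
open import Relation.Binary.PropositionalEquality using (_≡_; _≢_; refl; sym; trans; cong; cong₂; subst; _≗_; module ≡-Reasoning)

open Equivalence using (to; from)

s<s⇔ : ∀ {m n} → suc m < suc n ⇔ m < n
s<s⇔ = mk⇔ s<s⁻¹ s<s

<∸1⇔suc< : ∀ i m → i < m ∸ 1 ⇔ suc i < m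
<∸1⇔suc< i zero    = mk⇔ (λ ()) (λ ())
<∸1⇔suc< i (suc m) = mk⇔ s<s s<s⁻¹

applyUpTo-cong : ∀ {f g : ℕ → ℕ} → f ≗ g → ∀ n → applyUpTo f n ≡ applyUpTo g n
applyUpTo-cong f≗g zero    = refl
applyUpTo-cong f≗g (suc n) = cong₂ _∷_ (f≗g 0) (applyUpTo-cong (f≗g ∘ suc) n)

sum-map-* : ∀ c (xs : List ℕ) → sum (map (c *_) xs) ≡ c * sum xs
sum-map-* c []       = sym (*-zeroʳ c)
sum-map-* c (x ∷ xs) = trans (cong (c * x +_) (sum-map-* c xs)) (sym (*-distribˡ-+ c x (sum xs)))

module _ {p} {P : ℕ → Set p} (P? : Decidable P) where

  length-filter-applyUpTo : ∀ f {d n} → d ≤ n → (∀ i → P (f i) ⇔ i < d) →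
                            length (filter P? (applyUpTo f n)) ≡ d
  length-filter-applyUpTo f {zero}  {zero}  _         _   = refl
  length-filter-applyUpTo f {zero}  {suc n} _         P⇔ =
    trans (cong length (filter-reject P? (λ P₀ → n≮0 (to (P⇔ 0) P₀))))
          (length-filter-applyUpTo (f ∘ suc) {n = n} z≤n
            (λ i → mk⇔ (λ Pᵢ → contradiction (to (P⇔ (suc i)) Pᵢ) n≮0) λ ()))
  length-filter-applyUpTo f {suc d} {suc n} (s≤s d≤n) P⇔ =
    trans (cong length (filter-accept P? (from (P⇔ 0) z<s)))
          (cong suc (length-filter-applyUpTo (f ∘ suc) d≤n (λ i → s<s⇔ ⇔-∘ P⇔ (suc i))))

  module _ (P-pred : ∀ {i} → P (suc i) → P i) where

    P-≤ : ∀ {i j} → i ≤ j → P j → P i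
    P-≤ {j = zero}  z≤n   P₀   = P₀
    P-≤ {j = suc j} i≤1+j P₁₊ⱼ with m≤n⇒m<n∨m≡n i≤1+j
    ... | inj₁ i<1+j = P-≤ (s≤s⁻¹ i<1+j) (P-pred P₁₊ⱼ)
    ... | inj₂ refl  = P₁₊ⱼ

    ∃-threshold : ∀ n → ¬ P n → ∃[ d ] d ≤ n × (∀ i → P i ⇔ i < d)
    ∃-threshold zero    ¬P₀ = 0 , z≤n , λ i → mk⇔ (λ Pᵢ → contradiction (P-≤ z≤n Pᵢ) ¬P₀) λ ()
    ∃-threshold (suc n) ¬P₁₊ₙ with P? n
    ... | yes Pₙ = suc n , ≤-refl , λ i →
      mk⇔ (λ Pᵢ → ≰⇒> (λ 1+n≤i → ¬P₁₊ₙ (P-≤ 1+n≤i Pᵢ))) (λ i<1+n → P-≤ (s≤s⁻¹ i<1+n) Pₙ)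
    ... | no ¬Pₙ = let d , d≤n , P⇔ = ∃-threshold n ¬Pₙ in d , m≤n⇒m≤1+n d≤n , P⇔

    ⇔-<-length-filter-upTo : ∀ {n} → ¬ P n → ∀ i → P i ⇔ i < length (filter P? (upTo n))
    ⇔-<-length-filter-upTo {n} ¬Pₙ with ∃-threshold n ¬Pₙ
    ... | d , d≤n , P⇔ rewrite length-filter-applyUpTo id d≤n P⇔ = P⇔

rowLen-≤ : ∀ {b} {Y : List ℕ} → All (_≤ b) Y → ∀ i → rowLen Y i ≤ b
rowLen-≤ []       _       = z≤n
rowLen-≤ (p ∷ _)  zero    = p
rowLen-≤ (_ ∷ ps) (suc i) = rowLen-≤ ps i

rows-≤-first : ∀ {r rs} → Linked _≥_ (r ∷ rs) → All (_≤ r) (r ∷ rs)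
rows-≤-first = Linked⇒All (flip ≤-trans) ≤-refl

rowLen-≤-first : ∀ {r rs} → Linked _≥_ (r ∷ rs) → ∀ i → rowLen (r ∷ rs) i ≤ r
rowLen-≤-first l = rowLen-≤ (rows-≤-first l)

rowLen-suc-≤ : ∀ {Y} → Linked _≥_ Y → ∀ i → rowLen Y (suc i) ≤ rowLen Y i
rowLen-suc-≤ {[]}         _ _       = z≤n
rowLen-suc-≤ {r ∷ []}     _ _       = z≤n
rowLen-suc-≤ {r ∷ s ∷ ss} (s≤r ∷ _) zero    = s≤r
rowLen-suc-≤ {r ∷ s ∷ ss} (_ ∷ l)   (suc i) = rowLen-suc-≤ l i

rowLen-beyond : ∀ (Y : List ℕ) {i} → length Y ≤ i → rowLen Y i ≡ 0
rowLen-beyond []       _         = refl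
rowLen-beyond (_ ∷ rs) (s≤s L≤i) = rowLen-beyond rs L≤i

colLen-0 : ∀ {Y} → All (0 <_) Y → colLen Y 0 ≡ length Y
colLen-0 ps = cong length (filter-all (0 <?_) ps)

colLen-∷ : ∀ {r rs} → Linked _≥_ (r ∷ rs) → ∀ j → colLen (r ∷ rs) j ∸ 1 ≡ colLen rs j
colLen-∷ {r} {rs} l j with j <? r
... | yes j<r = cong (λ c → length c ∸ 1) (filter-accept (j <?_) j<r)
... | no  j≮r = begin
  colLen (r ∷ rs) j ∸ 1 ≡⟨ cong (λ c → length c ∸ 1) (filter-reject (j <?_) j≮r) ⟩
  colLen rs j ∸ 1       ≡⟨ cong (λ c → length c ∸ 1) noRowLonger ⟩
  0                     ≡⟨ cong length noRowLonger ⟨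
  colLen rs j           ∎
  where
  open ≡-Reasoning
  noRowLonger : filter (j <?_) rs ≡ []
  noRowLonger = filter-none (j <?_)
    (All.map (λ s≤r j<s → j≮r (<-≤-trans j<s s≤r)) (All.tail (rows-≤-first l)))

leg-firstColumn : ∀ {Y} → All (0 <_) Y → ∀ i → leg Y i 0 ≡ length Y ∸ suc i
leg-firstColumn ps i = cong (_∸ suc i) (colLen-0 ps)

hook-0-0 : ∀ {r rs} → All (0 <_) (r ∷ rs) → hook (r ∷ rs) 0 0 ≡ r + length rs
hook-0-0 {suc r} {rs} ps = begin
  r + leg (suc r ∷ rs) 0 0 + 1 ≡⟨ cong (λ l → r + l + 1) (leg-firstColumn ps 0) ⟩
  r + length rs + 1            ≡⟨ +-comm (r + length rs) 1 ⟩
  suc r + length rs            ∎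
  where open ≡-Reasoning
hook-0-0 {zero} (() ∷ _)

hook-suc-0 : ∀ {r rs} → All (0 <_) (r ∷ rs) → ∀ i → hook (r ∷ rs) (suc i) 0 ≡ hook rs i 0
hook-suc-0 {r} {rs} (0<r ∷ ps) i =
  cong (λ l → arm rs i 0 + l + 1) (trans (leg-firstColumn (0<r ∷ ps) (suc i)) (sym (leg-firstColumn ps i)))

hook≡2*[leg+1] : ∀ Y i j → arm Y i j ≡ leg Y i j + 1 → hook Y i j ≡ 2 * (leg Y i j + 1)
hook≡2*[leg+1] Y i j arm≡ = trans (cong (λ a → a + leg Y i j + 1) arm≡) (double (leg Y i j))
  where
  double : ∀ l → l + 1 + l + 1 ≡ 2 * (l + 1)
  double = solve-∀

hook-0-0-balanced : ∀ {r rs} → All (0 <_) (r ∷ rs) → arm (r ∷ rs) 0 0 ≡ leg (r ∷ rs) 0 0 + 1 →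
                    hook (r ∷ rs) 0 0 ≡ 2 * length (r ∷ rs)
hook-0-0-balanced {r} {rs} ps balanced = begin
  hook (r ∷ rs) 0 0               ≡⟨ hook≡2*[leg+1] (r ∷ rs) 0 0 balanced ⟩
  2 * (leg (r ∷ rs) 0 0 + 1)      ≡⟨ cong (λ l → 2 * (l + 1)) (leg-firstColumn ps 0) ⟩
  2 * (length rs + 1)             ≡⟨ cong (2 *_) (+-comm (length rs) 1) ⟩
  2 * length (r ∷ rs)             ∎
  where open ≡-Reasoning

dropFirstColumn : List ℕ → List ℕ
dropFirstColumn Y = map pred (filter (1 <?_) Y)

dropFirstColumn-isYoungDiagram : ∀ {Y} → IsYoungDiagram Y → IsYoungDiagram (dropFirstColumn Y)
dropFirstColumn-isYoungDiagram {Y} (l , _) =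
    Linked.map⁺ (Linked.map pred-mono-≤ (Linked.filter⁺ (1 <?_) (flip ≤-trans) l))
  , All.map⁺ (All.map <⇒≤pred (all-filter (1 <?_) Y))

sum-dropFirstColumn : ∀ {Y} → All (0 <_) Y → sum Y ≡ length Y + sum (dropFirstColumn Y)
sum-dropFirstColumn {[]}               []       = refl
sum-dropFirstColumn {suc zero ∷ rs}    (_ ∷ ps) = cong suc (sum-dropFirstColumn ps)
sum-dropFirstColumn {suc (suc r) ∷ rs} (_ ∷ ps) = begin
  suc (suc r) + sum rs                        ≡⟨ cong (suc (suc r) +_) (sum-dropFirstColumn ps) ⟩
  suc (suc r) + (length rs + sum rs′)         ≡⟨ shuffle r (length rs) (sum rs′) ⟩
  suc (length rs + (suc r + sum rs′))         ∎
  where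
  open ≡-Reasoning
  rs′ = dropFirstColumn rs
  shuffle : ∀ a b c → suc (suc a) + (b + c) ≡ suc (b + (suc a + c))
  shuffle = solve-∀

colLen-dropFirstColumn : ∀ (Y : List ℕ) j → colLen (dropFirstColumn Y) j ≡ colLen Y (suc j)
colLen-dropFirstColumn []                 j = refl
colLen-dropFirstColumn (zero ∷ rs)        j = colLen-dropFirstColumn rs j
colLen-dropFirstColumn (suc zero ∷ rs)    j = colLen-dropFirstColumn rs j
colLen-dropFirstColumn (suc (suc r) ∷ rs) j with j <ᵇ suc r  -- j <? suc r and suc j <? suc (suc r) both reduce to this test
... | true  = cong suc (colLen-dropFirstColumn rs j)
... | false = colLen-dropFirstColumn rs j

dropFirstColumn-thin : ∀ {Y} → All (_≤ 1) Y → dropFirstColumn Y ≡ []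
dropFirstColumn-thin ps = cong (map pred) (filter-none (1 <?_) (All.map (λ x≤1 1<x → <⇒≱ 1<x x≤1) ps))

rowLen-dropFirstColumn-thin : ∀ {r rs} → Linked _≥_ (r ∷ rs) → r ≤ 1 →
                              ∀ i → rowLen (dropFirstColumn rs) i ≡ rowLen (r ∷ rs) i ∸ 1
rowLen-dropFirstColumn-thin {r} {rs} l r≤1 i = begin
  rowLen (dropFirstColumn rs) i ≡⟨ cong (λ Z → rowLen Z i) (dropFirstColumn-thin rs≤1) ⟩
  0                             ≡⟨ m≤n⇒m∸n≡0 (≤-trans (rowLen-≤-first l i) r≤1) ⟨
  rowLen (r ∷ rs) i ∸ 1         ∎
  where
  open ≡-Reasoning
  rs≤1 : All (_≤ 1) rs
  rs≤1 = All.map (λ s≤r → ≤-trans s≤r r≤1) (All.tail (rows-≤-first l))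

rowLen-dropFirstColumn : ∀ {Y} → Linked _≥_ Y → ∀ i → rowLen (dropFirstColumn Y) i ≡ rowLen Y i ∸ 1
rowLen-dropFirstColumn {[]}               _ _       = refl
rowLen-dropFirstColumn {zero ∷ rs}        l i       = rowLen-dropFirstColumn-thin l z≤n i
rowLen-dropFirstColumn {suc zero ∷ rs}    l i       = rowLen-dropFirstColumn-thin l ≤-refl i
rowLen-dropFirstColumn {suc (suc r) ∷ rs} _ zero    = refl
rowLen-dropFirstColumn {suc (suc r) ∷ rs} l (suc i) = rowLen-dropFirstColumn (Linked.tail l) i

hook-dropFirstColumn : ∀ {r rs} → Linked _≥_ (r ∷ rs) →
                       ∀ i j → hook (r ∷ rs) (suc i) (suc j) ≡ hook (dropFirstColumn rs) i j
hook-dropFirstColumn {r} {rs} l i j = cong₂ (λ a b → a + b + 1) arm≡ leg≡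
  where
  open ≡-Reasoning
  arm≡ : arm (r ∷ rs) (suc i) (suc j) ≡ arm (dropFirstColumn rs) i j
  arm≡ = begin
    rowLen rs i ∸ (1 + suc j)                ≡⟨ ∸-+-assoc (rowLen rs i) 1 (suc j) ⟨
    rowLen rs i ∸ 1 ∸ suc j                  ≡⟨ cong (_∸ suc j) (rowLen-dropFirstColumn (Linked.tail l) i) ⟨
    rowLen (dropFirstColumn rs) i ∸ suc j    ∎
  leg≡ : leg (r ∷ rs) (suc i) (suc j) ≡ leg (dropFirstColumn rs) i j
  leg≡ = begin
    colLen (r ∷ rs) (suc j) ∸ (1 + suc i)    ≡⟨ ∸-+-assoc (colLen (r ∷ rs) (suc j)) 1 (suc i) ⟨
    colLen (r ∷ rs) (suc j) ∸ 1 ∸ suc i      ≡⟨ cong (_∸ suc i) (colLen-∷ l (suc j)) ⟩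
    colLen rs (suc j) ∸ suc i                ≡⟨ cong (_∸ suc i) (colLen-dropFirstColumn rs j) ⟨
    colLen (dropFirstColumn rs) j ∸ suc i    ∎

-- Frobenius' identity

-- d is the side of the Durfee square of Y.
IsDiagonalLength : List ℕ → ℕ → Set
IsDiagonalLength Y d = ∀ i → i < rowLen Y i ⇔ i < d

isDiagonalLength-diagLen : ∀ {Y} → Linked _≥_ Y → IsDiagonalLength Y (diagLen Y)
isDiagonalLength-diagLen {Y} l = ⇔-<-length-filter-upTo (λ i → i <? rowLen Y i) diagonal-pred outside
  where
  diagonal-pred : ∀ {i} → suc i < rowLen Y (suc i) → i < rowLen Y i
  diagonal-pred {i} 1+i<row = ≤-trans (n≤1+n (suc i)) (≤-trans 1+i<row (rowLen-suc-≤ l i))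
  outside : ¬ length Y < rowLen Y (length Y)
  outside L<row = n≮0 (subst (length Y <_) (rowLen-beyond Y ≤-refl) L<row)

isDiagonalLength-dropFirstColumn : ∀ {r rs d} → Linked _≥_ (r ∷ rs) → IsDiagonalLength (r ∷ rs) (suc d) →
                                   IsDiagonalLength (dropFirstColumn rs) d
isDiagonalLength-dropFirstColumn {r} {rs} l diag i
  rewrite rowLen-dropFirstColumn (Linked.tail l) i = s<s⇔ ⇔-∘ (diag (suc i) ⇔-∘ <∸1⇔suc< i (rowLen rs i))

sum≡sum-applyUpTo-diagonalHooks : ∀ d {Y} → IsYoungDiagram Y → IsDiagonalLength Y d →
                                  sum Y ≡ sum (applyUpTo (λ i → hook Y i i) d)
sum≡sum-applyUpTo-diagonalHooks zero    {[]}     _             _    = refl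
sum≡sum-applyUpTo-diagonalHooks zero    {r ∷ _}  (_ , 0<r ∷ _) diag = contradiction (to (diag 0) 0<r) n≮0
sum≡sum-applyUpTo-diagonalHooks (suc d) {[]}     _             diag = contradiction (from (diag 0) z<s) n≮0
sum≡sum-applyUpTo-diagonalHooks (suc d) {r ∷ rs} (l , ps)      diag = begin
  r + sum rs                                                      ≡⟨ cong (r +_) (sum-dropFirstColumn (All.tail ps)) ⟩
  r + (length rs + sum rs′)                                       ≡⟨ +-assoc r (length rs) (sum rs′) ⟨
  r + length rs + sum rs′                                         ≡⟨ cong₂ _+_ (sym (hook-0-0 ps)) rest ⟩
  hook Y 0 0 + sum (applyUpTo (λ i → hook rs′ i i) d)             ≡⟨ cong (λ hs → hook Y 0 0 + sum hs) (applyUpTo-cong (λ i → hook-dropFirstColumn l i i) d) ⟨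
  hook Y 0 0 + sum (applyUpTo (λ i → hook Y (suc i) (suc i)) d)   ∎
  where
  open ≡-Reasoning
  Y   = r ∷ rs
  rs′ = dropFirstColumn rs
  rest : sum rs′ ≡ sum (applyUpTo (λ i → hook rs′ i i) d)
  rest = sum≡sum-applyUpTo-diagonalHooks d (dropFirstColumn-isYoungDiagram (Linked.tail l , All.tail ps))
                                           (isDiagonalLength-dropFirstColumn l diag)

sum≡sum-diagHooks : ∀ {Y} → IsYoungDiagram Y → sum Y ≡ sum (diagHooks Y)
sum≡sum-diagHooks {Y} young@(l , _) = begin
  sum Y                                                   ≡⟨ sum≡sum-applyUpTo-diagonalHooks (diagLen Y) young (isDiagonalLength-diagLen l) ⟩
  sum (applyUpTo (λ i → hook Y i i) (diagLen Y))          ≡⟨ cong sum (map-upTo (λ i → hook Y i i) (diagLen Y)) ⟨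
  sum (diagHooks Y)                                       ∎
  where open ≡-Reasoning

firstColHooks-∷ : ∀ {r rs} → All (0 <_) (r ∷ rs) → firstColHooks (r ∷ rs) ≡ (r + length rs) ∷ firstColHooks rs
firstColHooks-∷ {r} {rs} ps = begin
  firstColHooks (r ∷ rs)                                          ≡⟨ map-upTo (λ i → hook (r ∷ rs) i 0) (suc (length rs)) ⟩
  hook (r ∷ rs) 0 0 ∷ applyUpTo (λ i → hook (r ∷ rs) (suc i) 0) (length rs)
    ≡⟨ cong₂ _∷_ (hook-0-0 ps) (applyUpTo-cong (hook-suc-0 ps) (length rs)) ⟩
  (r + length rs) ∷ applyUpTo (λ i → hook rs i 0) (length rs)    ≡⟨ cong ((r + length rs) ∷_) (map-upTo (λ i → hook rs i 0) (length rs)) ⟨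
  (r + length rs) ∷ firstColHooks rs                              ∎
  where open ≡-Reasoning

tri : ℕ → ℕ
tri zero    = 0
tri (suc n) = n + tri n

sum-firstColHooks : ∀ {Y} → All (0 <_) Y → sum (firstColHooks Y) ≡ sum Y + tri (length Y)
sum-firstColHooks {[]}     []              = refl
sum-firstColHooks {r ∷ rs} ps@(_ ∷ rs-pos) = begin
  sum (firstColHooks (r ∷ rs))                ≡⟨ cong sum (firstColHooks-∷ ps) ⟩
  r + length rs + sum (firstColHooks rs)      ≡⟨ cong (r + length rs +_) (sum-firstColHooks rs-pos) ⟩
  r + length rs + (sum rs + tri (length rs))  ≡⟨ shuffle r (length rs) (sum rs) (tri (length rs)) ⟩
  r + sum rs + (length rs + tri (length rs))  ∎
  where
  open ≡-Reasoning
  shuffle : ∀ a b c d → a + b + (c + d) ≡ a + c + (b + d)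
  shuffle = solve-∀

hook-firstColumn-antitone : ∀ {Y} → Linked _≥_ Y → ∀ i → hook Y (suc i) 0 ≤ hook Y i 0
hook-firstColumn-antitone {Y} l i =
  +-monoˡ-≤ 1 (+-mono-≤ (∸-monoˡ-≤ 1 (rowLen-suc-≤ l i)) (∸-monoʳ-≤ (colLen Y 0) (n≤1+n (suc i))))

firstColHooks-isPartition : ∀ {Y} → IsYoungDiagram Y → IsPartitionOf (firstColHooks Y) (sum Y + tri (length Y))
firstColHooks-isPartition {Y} (l , ps) = antitone , positive , sum-firstColHooks ps
  where
  antitone : Linked _≥_ (firstColHooks Y)
  antitone = subst (Linked _≥_) (sym (map-upTo (λ i → hook Y i 0) (length Y)))
                   (Linked.applyUpTo⁺₂ (λ i → hook Y i 0) (length Y) (hook-firstColumn-antitone l))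
  positive : All (0 <_) (firstColHooks Y)
  positive = All.map⁺ (All.universal (λ i → m≤n+m 1 (arm Y i 0 + leg Y i 0)) (upTo (length Y)))

tri[1+n]*2≡n*[n+1] : ∀ n → tri (suc n) * 2 ≡ n * (n + 1)
tri[1+n]*2≡n*[n+1] zero    = refl
tri[1+n]*2≡n*[n+1] (suc n) = begin
  (suc n + tri (suc n)) * 2     ≡⟨ *-distribʳ-+ 2 (suc n) (tri (suc n)) ⟩
  suc n * 2 + tri (suc n) * 2   ≡⟨ cong (suc n * 2 +_) (tri[1+n]*2≡n*[n+1] n) ⟩
  suc n * 2 + n * (n + 1)       ≡⟨ expand n ⟩
  suc n * (suc n + 1)           ∎
  where
  open ≡-Reasoning
  expand : ∀ n → suc n * 2 + n * (n + 1) ≡ suc n * (suc n + 1)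
  expand = solve-∀

T≡tri[1+n] : ∀ n → T n ≡ tri (suc n)
T≡tri[1+n] n = trans (cong (_/ 2) (sym (tri[1+n]*2≡n*[n+1] n))) (m*n/n≡m (tri (suc n)) 2)

T≡2L+2k+tri[L] : ∀ k L → 2 ≤ k → 2 * L ≡ 2 * (2 * k ∸ 1) ∸ 4 → T (2 * k ∸ 1) ≡ 2 * L + 2 * k + tri L
T≡2L+2k+tri[L] (suc (suc j)) L (s≤s (s≤s _)) 2L≡ = begin
  T (2 * (2 + j) ∸ 1)                                ≡⟨ cong T n≡ ⟩
  T (3 + 2 * j)                                      ≡⟨ T≡tri[1+n] (3 + 2 * j) ⟩
  tri (4 + 2 * j)                                    ≡⟨ unfold-tri j (tri (1 + 2 * j)) ⟩
  2 * (1 + 2 * j) + 2 * (2 + j) + tri (1 + 2 * j)    ≡⟨ cong (λ l → 2 * l + 2 * (2 + j) + tri l) L≡ ⟨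
  2 * L + 2 * (2 + j) + tri L                        ∎
  where
  open ≡-Reasoning
  double-n : ∀ j → 2 * (2 + j) ≡ 4 + 2 * j
  double-n = solve-∀
  double-n∸4 : ∀ j → 2 * (3 + 2 * j) ≡ 4 + 2 * (1 + 2 * j)
  double-n∸4 = solve-∀
  unfold-tri : ∀ j t → 3 + 2 * j + (2 + 2 * j + (1 + 2 * j + t)) ≡ 2 * (1 + 2 * j) + 2 * (2 + j) + t
  unfold-tri = solve-∀
  n≡ : 2 * (2 + j) ∸ 1 ≡ 3 + 2 * j
  n≡ = cong (_∸ 1) (double-n j)
  L≡ : L ≡ 1 + 2 * j
  L≡ = *-cancelˡ-≡ L (1 + 2 * j) 2
         (trans 2L≡ (trans (cong (λ m → 2 * m ∸ 4) n≡) (cong (_∸ 4) (double-n∸4 j))))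

proposition3p21 : (k : ℕ) → 4 ≤ k →
    (η : List ℕ) → InD k η → η ≢ (3 ∷ (k ∸ 3) ∷ []) →
    (Y : List ℕ) → IsYoungDiagram Y →
    diagLen Y ≡ suc (length η) →
    diagHooks Y ≡ (2 * (2 * k ∸ 1) ∸ 4) ∷ map (2 *_) (reverse η) →
    All (λ i → arm Y i i ≡ leg Y i i + 1) (Data.List.upTo (diagLen Y)) →
    IsPartitionOf (firstColHooks Y) (T (2 * k ∸ 1))
proposition3p21 k _   η _                  _ []        _               () _ _
proposition3p21 k 4≤k η (_ , _ , _ , Ση≡k) _ Y@(_ ∷ _) young@(_ , ps) diagLen≡ diagHooks≡ balanced =
  subst (IsPartitionOf (firstColHooks Y)) (sym T≡size+tri) (firstColHooks-isPartition young)
  where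
  open ≡-Reasoning
  hook₀₀≡given : hook Y 0 0 ≡ 2 * (2 * k ∸ 1) ∸ 4
  hook₀₀≡given = ∷-injectiveˡ (subst (λ d → map (λ i → hook Y i i) (upTo d) ≡ _) diagLen≡ diagHooks≡)
  hook₀₀≡2L : hook Y 0 0 ≡ 2 * length Y
  hook₀₀≡2L = hook-0-0-balanced ps
    (All.head (subst (λ d → All (λ i → arm Y i i ≡ leg Y i i + 1) (upTo d)) diagLen≡ balanced))
  size : sum Y ≡ 2 * length Y + 2 * k
  size = begin
    sum Y                                               ≡⟨ sum≡sum-diagHooks young ⟩
    sum (diagHooks Y)                                   ≡⟨ cong sum diagHooks≡ ⟩
    2 * (2 * k ∸ 1) ∸ 4 + sum (map (2 *_) (reverse η))  ≡⟨ cong₂ _+_ (trans (sym hook₀₀≡given) hook₀₀≡2L) (sum-map-* 2 (reverse η)) ⟩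
    2 * length Y + 2 * sum (reverse η)                  ≡⟨ cong (λ s → 2 * length Y + 2 * s) (trans (sum-↭ (↭-reverse η)) Ση≡k) ⟩
    2 * length Y + 2 * k                                ∎
  T≡size+tri : T (2 * k ∸ 1) ≡ sum Y + tri (length Y)
  T≡size+tri = begin
    T (2 * k ∸ 1)                         ≡⟨ T≡2L+2k+tri[L] k (length Y) (≤-trans (s≤s (s≤s z≤n)) 4≤k)
                                                             (trans (sym hook₀₀≡2L) hook₀₀≡given) ⟩
    2 * length Y + 2 * k + tri (length Y) ≡⟨ cong (_+ tri (length Y)) size ⟨
    sum Y + tri (length Y)                ∎
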